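{- Consider the following setting (the searching step of a Wu-Manber-type multiple order-preserving matching algorithm). Let $\Sigma$ be a finite alphabet of numbers with $\sigma=|\Sigma|$. Let $P_1,\dots,P_k$ be patterns over $\Sigma$, let $m = \min_i |P_i|$, $M = \sum_{i=1}^k |P_i|$, and $P_i' = P_i[1..m]$. The block length is set to $b = 1.5\log M/\log\log M$ (with $b\le m$, $b \le \sigma$), and every length-$b$ substring of every $P_i'$ and of the text has pairwise distinct characters. At each iteration of the search, the algorithm reads a block $x = T[pos-b+1..pos]$ of the text; the verification step of that iteration consists of, for every pattern $P_i$ with $Pre(P_i'[m-b+1..m]) = Pre(x)$, checking whether $P_i$ order-preservingly matches the text at the corresponding position, which costs $O(|P_i|)$ time (and no verification cost is incurred for other patterns). Assume that the block $x$ read at an iteration is uniformly distributed among the ${}_\sigma P_b=\sigma!/(\sigma-b)!$ strings of length $b$ over $\Sigma$ with pairwise distinct characters. Then the expected cost of the verification step at each iteration is $O(1)$.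
   Context: For a string $z$ and a character $c$, $rank_z(c) = 1 + |\{ i : z[i] < c,\ 1 \le i \le |z| \}|$. With $z_i = z[1..i]$, the prefix representation is $Pre(z) = (rank_{z_1}(z[1]), \dots, rank_{z_{|z|}}(z[|z|]))$. The natural representation is $Nat(z) = (rank_z(z[1]), \dots, rank_z(z[|z|]))$; a pattern $P$ order-preservingly matches the text $T$ at position $i$ if $Nat(P) = Nat(T[i-|P|+1..i])$. The notation $z[a..c]$ denotes the substring $(z[a],\dots,z[c])$. -}

module Defs where

open import Data.Nat using (ℕ; zero; suc; _+_; _*_; _∸_; _≤_; _<_; _<?_)
open import Data.Nat.Logarithm using (⌊log₂_⌋)
open import Data.Bool using (Bool; true; false; if_then_else_)
open import Data.List using (List; []; _∷_; _++_; [_]; length; filter; map; concatMap; take; drop)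
open import Data.Nat.ListAction using (sum)
open import Data.List.Properties using (≡-dec)
import Data.Nat as N
open import Data.List.Relation.Unary.Unique.DecPropositional N._≟_ using (Unique; unique?)
open import Relation.Nullary.Decidable using (⌊_⌋)

rank : List ℕ → ℕ → ℕ
rank z c = suc (length (filter (_<? c) z))

preFrom : List ℕ → List ℕ → List ℕ
preFrom acc [] = []
preFrom acc (c ∷ cs) = rank (acc ++ [ c ]) c ∷ preFrom (acc ++ [ c ]) cs

Pre : List ℕ → List ℕ
Pre z = preFrom [] z

-- z[a..c] with 1-based inclusive indices: drop (a-1) (take c z)
substr : List ℕ → ℕ → ℕ → List ℕ
substr z a c = drop (a ∸ 1) (take c z)

-- all strings of length b over the alphabet Σ (listed with multiplicity 1 when Σ has no repeats)
allStrings : List ℕ → ℕ → List (List ℕ)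
allStrings Σ zero = [] ∷ []
allStrings Σ (suc b) = concatMap (λ c → map (c ∷_) (allStrings Σ b)) Σ

distinctStrings : List ℕ → ℕ → List (List ℕ)
distinctStrings Σ b = filter unique? (allStrings Σ b)

verifCost : List (List ℕ) → ℕ → ℕ → List ℕ → ℕ
verifCost Ps m b x =
  sum (map (λ P → if ⌊ ≡-dec N._≟_ (Pre (substr (take m P) (suc (m ∸ b)) m)) (Pre x) ⌋
                  then length P else 0) Ps)

-- total verification cost over the sample space (expected cost = this / |sample space|)
totalCost : List (List ℕ) → List ℕ → ℕ → ℕ → ℕ
totalCost Ps Σ m b = sum (map (verifCost Ps m b) (distinctStrings Σ b))

totalLength : List (List ℕ) → ℕ
totalLength Ps = sum (map length Ps)

-- Averaged over the blocks x, the verification cost is the sum over i of |P_i| times the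
-- probability that Pre x equals the prefix representation of the last block of P_i'.
-- Each such probability is at most 1/b!.  Indeed, let a be the least letter of the alphabet:
-- a word with distinct letters either avoids a, or comes from a shorter word y by inserting a
-- at one of the |y| + 1 positions; such an insertion turns Pre y into a sequence from which
-- both the position (the last rank 1) and Pre y can be read off.  Induction on the alphabet
-- then gives b! · #{x : Pre x = p} ≤ #{x with distinct letters}.  So the expected cost is at
-- most M / b!, and the choice b ≈ 1.5 log M / log log M forces b! ≥ M once log log M ≥ 54
-- (with t = 2^r for r ≈ (5/6) log log M one has b! ≥ t^(b - t) ≥ 2^(⌊log M⌋ + 1)),
-- while for smaller log log M the number M itself is below the constant 2^2^54.

module Submission where

open import Defs
open import Data.Bool using (Bool; true; false; if_then_else_)
open import Data.Bool.ListAction using (any)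
open import Data.Bool.Properties using (∨-zeroʳ)
open import Data.List using (List; []; _∷_; _++_; [_]; length; filter; map; concatMap; take; drop)
open import Data.List.Membership.Propositional using (_∈_)
open import Data.List.Properties using (map-∘; map-id; map-++; filter-++; length-++; filter-accept; filter-none; ≡-dec)
open import Data.List.Relation.Unary.All as All using (All; []; _∷_)
import Data.List.Relation.Unary.All.Properties as All
open import Data.List.Relation.Unary.AllPairs.Core using ([]; _∷_)
open import Data.List.Relation.Unary.Any using (Any; here; there)
import Data.Nat as N
open import Data.List.Relation.Unary.Unique.DecPropositional N._≟_ using (Unique; unique?)
open import Data.List.Relation.Unary.Unique.Propositional.Properties using (Unique[x∷xs]⇒x∉xs)
open import Data.Nat.Base
open import Data.Nat.DivMod using (_/_; _%_; m≡m%n+[m/n]*n; m%n<n)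
open import Data.Nat.ListAction using (sum)
open import Data.Nat.ListAction.Properties using (sum-++)
open import Data.Nat.Logarithm using (⌊log₂_⌋; ⌊log₂⌋-mono-≤; ⌊log₂⌊n/2⌋⌋≡⌊log₂n⌋∸1; ⌊log₂[2^n]⌋≡n)
open import Data.Nat.Properties
open import Algebra.Properties.CommutativeSemigroup +-commutativeSemigroup using (interchange; x∙yz≈y∙xz)
open import Algebra.Properties.CommutativeSemigroup *-commutativeSemigroup using () renaming (x∙yz≈y∙xz to x*[y*z]≡y*[x*z])
open import Data.Nat.Tactic.RingSolver using (solve-∀)
open import Data.Product using (∃; ∃₂; _×_; _,_; proj₁; proj₂; map₁; map₂)
open import Function using (_∘_)
open import Relation.Binary.PropositionalEquality hiding ([_])
open import Relation.Nullary using (Dec; yes; no; ¬_; contradiction)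
open import Relation.Nullary.Decidable using (⌊_⌋)

module _ {A : Set} where

  sum-map-cong : ∀ {f g : A → ℕ} xs → (∀ x → f x ≡ g x) → sum (map f xs) ≡ sum (map g xs)
  sum-map-cong []       f≗g = refl
  sum-map-cong (x ∷ xs) f≗g = cong₂ _+_ (f≗g x) (sum-map-cong xs f≗g)

  sum-map-mono : ∀ {f g : A → ℕ} xs → (∀ {x} → x ∈ xs → f x ≤ g x) → sum (map f xs) ≤ sum (map g xs)
  sum-map-mono []       f≤g = z≤n
  sum-map-mono (x ∷ xs) f≤g = +-mono-≤ (f≤g (here refl)) (sum-map-mono xs (f≤g ∘ there))

  sum-map-+ : ∀ (f g : A → ℕ) xs → sum (map (λ x → f x + g x) xs) ≡ sum (map f xs) + sum (map g xs)
  sum-map-+ f g []       = refl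
  sum-map-+ f g (x ∷ xs) = trans (cong (f x + g x +_) (sum-map-+ f g xs)) (interchange (f x) (g x) _ _)

  sum-map-* : ∀ k (f : A → ℕ) xs → sum (map (λ x → k * f x) xs) ≡ k * sum (map f xs)
  sum-map-* k f []       = sym (*-zeroʳ k)
  sum-map-* k f (x ∷ xs) = trans (cong (k * f x +_) (sum-map-* k f xs)) (sym (*-distribˡ-+ k (f x) _))

  sum-map-concatMap : ∀ (g : A → ℕ) {B : Set} (F : B → List A) ys →
                      sum (map g (concatMap F ys)) ≡ sum (map (λ y → sum (map g (F y))) ys)
  sum-map-concatMap g F []       = refl
  sum-map-concatMap g F (y ∷ ys) = begin
    sum (map g (F y ++ concatMap F ys))             ≡⟨ cong sum (map-++ g (F y) _) ⟩
    sum (map g (F y) ++ map g (concatMap F ys))     ≡⟨ sum-++ (map g (F y)) _ ⟩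
    sum (map g (F y)) + sum (map g (concatMap F ys)) ≡⟨ cong (sum (map g (F y)) +_) (sum-map-concatMap g F ys) ⟩
    sum (map g (F y)) + sum (map (λ y → sum (map g (F y))) ys) ∎
    where open ≡-Reasoning

  *-sum-map-≤ : ∀ k N (l f : A → ℕ) xs → (∀ x → k * f x ≤ N) → k * sum (map (λ x → l x * f x) xs) ≤ sum (map l xs) * N
  *-sum-map-≤ k N l f xs kf≤N = begin
    k * sum (map (λ x → l x * f x) xs)     ≡⟨ sum-map-* k _ xs ⟨
    sum (map (λ x → k * (l x * f x)) xs)   ≡⟨ sum-map-cong xs (λ x → x*[y*z]≡y*[x*z] k (l x) (f x)) ⟩
    sum (map (λ x → l x * (k * f x)) xs)   ≤⟨ sum-map-mono xs (λ {x} _ → *-monoʳ-≤ (l x) (kf≤N x)) ⟩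
    sum (map (λ x → l x * N) xs)           ≡⟨ sum-map-cong xs (λ x → *-comm (l x) N) ⟩
    sum (map (λ x → N * l x) xs)           ≡⟨ sum-map-* N l xs ⟩
    N * sum (map l xs)                     ≡⟨ *-comm N _ ⟩
    sum (map l xs) * N                     ∎
    where open ≤-Reasoning

  length≡sum-map-1 : ∀ (xs : List A) → length xs ≡ sum (map (λ _ → 1) xs)
  length≡sum-map-1 []       = refl
  length≡sum-map-1 (x ∷ xs) = cong suc (length≡sum-map-1 xs)

𝟙 : {A : Set} → Dec A → ℕ
𝟙 d = if ⌊ d ⌋ then 1 else 0

module _ {A : Set} where

  𝟙-yes : (d : Dec A) → A → 𝟙 d ≡ 1
  𝟙-yes (yes _) _ = refl
  𝟙-yes (no ¬a) a = contradiction a ¬a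

  𝟙-no : (d : Dec A) → ¬ A → 𝟙 d ≡ 0
  𝟙-no (yes a) ¬a = contradiction a ¬a
  𝟙-no (no _)  _  = refl

  𝟙≤1 : (d : Dec A) → 𝟙 d ≤ 1
  𝟙≤1 (yes _) = ≤-refl
  𝟙≤1 (no _)  = z≤n

module _ {A B : Set} where

  𝟙-mono : (A → B) → (d : Dec A) (e : Dec B) → 𝟙 d ≤ 𝟙 e
  𝟙-mono f (no _)  _       = z≤n
  𝟙-mono f (yes _) (yes _) = ≤-refl
  𝟙-mono f (yes a) (no ¬b) = contradiction (f a) ¬b

  𝟙*𝟙≤𝟙 : (d : Dec A) (e : Dec B) → 𝟙 d * 𝟙 e ≤ 𝟙 d
  𝟙*𝟙≤𝟙 (no _)  _       = z≤n
  𝟙*𝟙≤𝟙 (yes _) (yes _) = ≤-refl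
  𝟙*𝟙≤𝟙 (yes _) (no _)  = z≤n

  𝟙*𝟙≢0 : (d : Dec A) (e : Dec B) → 𝟙 d * 𝟙 e ≢ 0 → A × B
  𝟙*𝟙≢0 (yes a) (yes b) _  = a , b
  𝟙*𝟙≢0 (yes _) (no _)  ≢0 = contradiction refl ≢0
  𝟙*𝟙≢0 (no _)  _       ≢0 = contradiction refl ≢0

if-then-else-0 : ∀ (c : Bool) n → (if c then n else 0) ≡ n * (if c then 1 else 0)
if-then-else-0 true  n = sym (*-identityʳ n)
if-then-else-0 false n = sym (*-zeroʳ n)

sum-map-filter : ∀ {A : Set} {P : A → Set} (P? : ∀ x → Dec (P x)) (g : A → ℕ) xs →
                 sum (map g (filter P? xs)) ≡ sum (map (λ x → 𝟙 (P? x) * g x) xs)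
sum-map-filter P? g []       = refl
sum-map-filter P? g (x ∷ xs) with P? x
... | yes _ = cong₂ _+_ (sym (+-identityʳ (g x))) (sum-map-filter P? g xs)
... | no  _ = sum-map-filter P? g xs

sumTo : ℕ → (ℕ → ℕ) → ℕ
sumTo zero    f = f 0
sumTo (suc n) f = f 0 + sumTo n (f ∘ suc)


*-≤-sumTo : ∀ n K (f : ℕ → ℕ) → (∀ i → K ≤ f i) → suc n * K ≤ sumTo n f
*-≤-sumTo zero    K f K≤f = ≤-trans (≤-reflexive (+-identityʳ K)) (K≤f 0)
*-≤-sumTo (suc n) K f K≤f = +-mono-≤ (K≤f 0) (*-≤-sumTo n K (f ∘ suc) (K≤f ∘ suc))

≤-unless-0 : ∀ {m K} → (m ≢ 0 → m ≤ K) → m ≤ K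
≤-unless-0 {zero}  _ = z≤n
≤-unless-0 {suc m} h = h λ ()

sumTo-≤-single : ∀ n j {K} (f : ℕ → ℕ) → (∀ i → i ≤ n → f i ≢ 0 → i ≡ j × f i ≤ K) → sumTo n f ≤ K
sumTo-≤-single zero    j       f h = ≤-unless-0 (proj₂ ∘ h 0 z≤n)
sumTo-≤-single (suc n) zero    f h =
  ≤-trans (+-mono-≤ (≤-unless-0 (proj₂ ∘ h 0 z≤n))
                    (sumTo-≤-single n 0 (f ∘ suc) λ i i≤n ≢0 → contradiction (proj₁ (h (suc i) (s≤s i≤n) ≢0)) λ ()))
          (≤-reflexive (+-identityʳ _))
sumTo-≤-single (suc n) (suc j) f h =
  +-mono-≤ (≤-unless-0 {K = 0} λ ≢0 → contradiction (proj₁ (h 0 z≤n ≢0)) λ ())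
           (sumTo-≤-single n j (f ∘ suc) λ i i≤n ≢0 → map₁ suc-injective (h (suc i) (s≤s i≤n) ≢0))

module _ {A : Set} where

  insertAt : ℕ → A → List A → List A
  insertAt i a y = take i y ++ a ∷ drop i y

  length-insertAt : ∀ i {a} y → length (insertAt i a y) ≡ suc (length y)
  length-insertAt zero    y       = refl
  length-insertAt (suc i) []      = refl
  length-insertAt (suc i) (c ∷ y) = cong suc (length-insertAt i y)

  sum-map-insertAt : ∀ i a y (f : A → ℕ) → sum (map f (insertAt i a y)) ≡ f a + sum (map f y)
  sum-map-insertAt zero    a y       f = refl
  sum-map-insertAt (suc i) a []      f = refl
  sum-map-insertAt (suc i) a (c ∷ y) f = trans (cong (f c +_) (sum-map-insertAt i a y f)) (x∙yz≈y∙xz (f c) (f a) _)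

  All-insertAt⁺ : ∀ {P : A → Set} i {a} y → P a → All P y → All P (insertAt i a y)
  All-insertAt⁺ zero    y       pa py         = pa ∷ py
  All-insertAt⁺ (suc i) []      pa []         = pa ∷ []
  All-insertAt⁺ (suc i) (c ∷ y) pa (pc ∷ py) = pc ∷ All-insertAt⁺ i y pa py

  All-insertAt⁻ : ∀ {P : A → Set} i {a} y → All P (insertAt i a y) → P a × All P y
  All-insertAt⁻ zero    y       (pa ∷ py)  = pa , py
  All-insertAt⁻ (suc i) []      (pa ∷ [])  = pa , []
  All-insertAt⁻ (suc i) (c ∷ y) (pc ∷ pay) = map₂ (pc ∷_) (All-insertAt⁻ i y pay)

Unique-insertAt⁺ : ∀ i {a : ℕ} y → All (a ≢_) y → Unique y → Unique (insertAt i a y)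
Unique-insertAt⁺ zero    y       a∉y       uy        = a∉y ∷ uy
Unique-insertAt⁺ (suc i) []      []        []        = [] ∷ []
Unique-insertAt⁺ (suc i) (c ∷ y) (a≢c ∷ a∉y) (c∉y ∷ uy) =
  All-insertAt⁺ i y (a≢c ∘ sym) c∉y ∷ Unique-insertAt⁺ i y a∉y uy

Unique-insertAt⁻ : ∀ i {a : ℕ} y → Unique (insertAt i a y) → Unique y
Unique-insertAt⁻ zero    y       (_ ∷ uy)    = uy
Unique-insertAt⁻ (suc i) []      _           = []
Unique-insertAt⁻ (suc i) (c ∷ y) (c∉ay ∷ uy) = proj₂ (All-insertAt⁻ i y c∉ay) ∷ Unique-insertAt⁻ i y uy

Unique-insertAt⇒∉ : ∀ i {a : ℕ} y → Unique (insertAt i a y) → All (a ≢_) y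
Unique-insertAt⇒∉ zero    y       (a∉y ∷ _)   = a∉y
Unique-insertAt⇒∉ (suc i) []      _           = []
Unique-insertAt⇒∉ (suc i) (c ∷ y) (c∉ay ∷ uy) = (proj₁ (All-insertAt⁻ i y c∉ay) ∘ sym) ∷ Unique-insertAt⇒∉ i y uy

sumWords : List ℕ → ℕ → (List ℕ → ℕ) → ℕ
sumWords Σ zero    g = g []
sumWords Σ (suc b) g = sum (map (λ c → sumWords Σ b (λ y → g (c ∷ y))) Σ)

sum-map-allStrings : ∀ Σ b (g : List ℕ → ℕ) → sum (map g (allStrings Σ b)) ≡ sumWords Σ b g
sum-map-allStrings Σ zero    g = +-identityʳ (g [])
sum-map-allStrings Σ (suc b) g = trans (sum-map-concatMap g _ Σ) (sum-map-cong Σ λ c →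
  trans (cong sum (sym (map-∘ (allStrings Σ b)))) (sum-map-allStrings Σ b _))

sumWords-mono : ∀ Σ b {g h : List ℕ → ℕ} → (∀ {y} → length y ≡ b → All (_∈ Σ) y → g y ≤ h y) →
                sumWords Σ b g ≤ sumWords Σ b h
sumWords-mono Σ zero    g≤h = g≤h refl []
sumWords-mono Σ (suc b) g≤h = sum-map-mono Σ λ c∈Σ → sumWords-mono Σ b λ |y|≡b y⊆Σ → g≤h (cong suc |y|≡b) (c∈Σ ∷ y⊆Σ)

sumWords-cong : ∀ Σ b {g h : List ℕ → ℕ} → (∀ y → g y ≡ h y) → sumWords Σ b g ≡ sumWords Σ b h
sumWords-cong Σ zero    g≗h = g≗h []
sumWords-cong Σ (suc b) g≗h = sum-map-cong Σ λ c → sumWords-cong Σ b (g≗h ∘ (c ∷_))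

sumWords-+ : ∀ Σ b (g h : List ℕ → ℕ) → sumWords Σ b (λ y → g y + h y) ≡ sumWords Σ b g + sumWords Σ b h
sumWords-+ Σ zero    g h = refl
sumWords-+ Σ (suc b) g h = trans (sum-map-cong Σ λ c → sumWords-+ Σ b _ _) (sum-map-+ _ _ Σ)

sumWords-* : ∀ Σ b k (g : List ℕ → ℕ) → sumWords Σ b (λ y → k * g y) ≡ k * sumWords Σ b g
sumWords-* Σ zero    k g = refl
sumWords-* Σ (suc b) k g = trans (sum-map-cong Σ λ c → sumWords-* Σ b k _) (sum-map-* k _ Σ)

sumWords-sum-map : ∀ Σ b {A : Set} (F : A → List ℕ → ℕ) xs →
                   sumWords Σ b (λ y → sum (map (λ x → F x y) xs)) ≡ sum (map (λ x → sumWords Σ b (F x)) xs)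
sumWords-sum-map Σ b F []       = sumWords-* Σ b 0 (λ _ → 0)
sumWords-sum-map Σ b F (x ∷ xs) = trans (sumWords-+ Σ b (F x) _) (cong (sumWords Σ b (F x) +_) (sumWords-sum-map Σ b F xs))

sumWords-avoiding : ∀ i a Σ b (h : List ℕ → ℕ) → (∀ y → a ∈ y → h y ≡ 0) →
                    sumWords (insertAt i a Σ) b h ≡ sumWords Σ b h
sumWords-avoiding i a Σ zero    h _   = refl
sumWords-avoiding i a Σ (suc b) h h-a = begin
  sum (map F (insertAt i a Σ)) ≡⟨ sum-map-insertAt i a Σ F ⟩
  F a + sum (map F Σ)          ≡⟨ cong₂ _+_ Fa≡0 (sum-map-cong Σ λ c → sumWords-avoiding i a Σ b _ λ y a∈y → h-a (c ∷ y) (there a∈y)) ⟩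
  sumWords Σ (suc b) h         ∎
  where
  open ≡-Reasoning
  F : ℕ → ℕ
  F c = sumWords (insertAt i a Σ) b (λ y → h (c ∷ y))
  Fa≡0 : F a ≡ 0
  Fa≡0 = trans (sumWords-cong _ b λ y → h-a (a ∷ y) (here refl)) (sumWords-* _ b 0 (λ _ → 0))

SupportedOnUnique : (List ℕ → ℕ) → Set
SupportedOnUnique g = ∀ y → ¬ Unique y → g y ≡ 0

sumInsertions : ℕ → (List ℕ → ℕ) → List ℕ → ℕ
sumInsertions a g y = sumTo (length y) (λ i → g (insertAt i a y))

-- A word over insertAt i a Σ with distinct letters either avoids a, or arises from a
-- shorter word over Σ by inserting a at one of its positions.
sumWords-insertAt : ∀ i a Σ b (g : List ℕ → ℕ) → SupportedOnUnique g →
                    sumWords (insertAt i a Σ) (suc b) g ≡ sumWords Σ (suc b) g + sumWords Σ b (sumInsertions a g)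
sumWords-insertAt i a Σ zero    g _ = trans (sum-map-insertAt i a Σ _) (+-comm (g (a ∷ [])) _)
sumWords-insertAt i a Σ (suc b) g g-supp = begin
  sum (map F (insertAt i a Σ))                  ≡⟨ sum-map-insertAt i a Σ F ⟩
  F a + sum (map F Σ)                           ≡⟨ cong₂ _+_ (sumWords-avoiding i a Σ (suc b) _ λ y a∈y → g-supp (a ∷ y) (λ u → Unique[x∷xs]⇒x∉xs u a∈y))
                                                             (sum-map-cong Σ λ c → sumWords-insertAt i a Σ b _ λ y ¬uy → g-supp (c ∷ y) λ { (_ ∷ uy) → ¬uy uy }) ⟩
  A + sum (map (λ c → Rest c + X c) Σ)          ≡⟨ cong (A +_) (sum-map-+ Rest X Σ) ⟩
  A + (sumWords Σ (suc (suc b)) g + sum (map X Σ)) ≡⟨ x∙yz≈y∙xz A (sumWords Σ (suc (suc b)) g) (sum (map X Σ)) ⟩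
  sumWords Σ (suc (suc b)) g + (A + sum (map X Σ)) ≡⟨ cong (sumWords Σ (suc (suc b)) g +_) (sym (begin
    sumWords Σ (suc b) (sumInsertions a g)      ≡⟨ sum-map-cong Σ (λ c → sumWords-+ Σ b _ _) ⟩
    sum (map (λ c → sumWords Σ b (λ y → g (a ∷ c ∷ y)) + X c) Σ) ≡⟨ sum-map-+ _ X Σ ⟩
    A + sum (map X Σ)                           ∎)) ⟩
  sumWords Σ (suc (suc b)) g + sumWords Σ (suc b) (sumInsertions a g) ∎
  where
  open ≡-Reasoning
  F Rest X : ℕ → ℕ
  F c    = sumWords (insertAt i a Σ) (suc b) (λ y → g (c ∷ y))
  Rest c = sumWords Σ (suc b) (λ y → g (c ∷ y))
  X c    = sumWords Σ b (sumInsertions a (λ y → g (c ∷ y)))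
  A = sumWords Σ (suc b) (λ y → g (a ∷ y))

rank-++ : ∀ xs ys c → rank (xs ++ ys) c ≡ rank xs c + length (filter (N._<? c) ys)
rank-++ xs ys c = cong suc (trans (cong length (filter-++ (N._<? c) xs ys)) (length-++ (filter (N._<? c) xs)))

rank-++-below : ∀ {a c} xs → a < c → rank (xs ++ [ a ]) c ≡ suc (rank xs c)
rank-++-below {a} {c} xs a<c = trans (rank-++ xs [ a ] c)
  (trans (cong (λ l → rank xs c + length l) (filter-accept (N._<? c) a<c)) (+-comm (rank xs c) 1))

rank-min : ∀ {a} xs → All (a <_) xs → rank (xs ++ [ a ]) a ≡ 1
rank-min {a} xs a<xs = cong (suc ∘ length) (filter-none (N._<? a) (All.++⁺ (All.map <⇒≯ a<xs) (<-irrefl refl ∷ [])))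

preFrom-shift : ∀ {a} acc acc′ y → (∀ {c} → a < c → rank acc′ c ≡ suc (rank acc c)) → All (a <_) y →
                preFrom acc′ y ≡ map suc (preFrom acc y)
preFrom-shift acc acc′ []      _   _             = refl
preFrom-shift {a} acc acc′ (c ∷ y) inv (a<c ∷ a<y) =
  cong₂ _∷_ (inv′ a<c) (preFrom-shift (acc ++ [ c ]) (acc′ ++ [ c ]) y inv′ a<y)
  where
  inv′ : ∀ {d} → a < d → rank (acc′ ++ [ c ]) d ≡ suc (rank (acc ++ [ c ]) d)
  inv′ {d} a<d = trans (rank-++ acc′ [ c ] d) (trans (cong (_+ length (filter (N._<? d) [ c ])) (inv a<d)) (cong suc (sym (rank-++ acc [ c ] d))))

insertMin : ℕ → List ℕ → List ℕ
insertMin zero    v       = 1 ∷ map suc v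
insertMin (suc i) []      = 1 ∷ []
insertMin (suc i) (x ∷ v) = x ∷ insertMin i v

preFrom-insertAt-min : ∀ {a} acc i y → All (a <_) acc → All (a <_) y →
                       preFrom acc (insertAt i a y) ≡ insertMin i (preFrom acc y)
preFrom-insertAt-min acc zero    y       a<acc a<y = cong₂ _∷_ (rank-min acc a<acc) (preFrom-shift acc _ y (rank-++-below acc) a<y)
preFrom-insertAt-min acc (suc i) []      a<acc _   = cong (_∷ []) (rank-min acc a<acc)
preFrom-insertAt-min acc (suc i) (c ∷ y) a<acc (a<c ∷ a<y) =
  cong (rank (acc ++ [ c ]) c ∷_) (preFrom-insertAt-min (acc ++ [ c ]) i y (All.++⁺ a<acc (a<c ∷ [])) a<y)

Pre-insertAt-min : ∀ {a} i y → All (a <_) y → Pre (insertAt i a y) ≡ insertMin i (Pre y)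
Pre-insertAt-min i y = preFrom-insertAt-min [] i y []

preFrom-positive : ∀ acc y → All (0 <_) (preFrom acc y)
preFrom-positive acc []      = []
preFrom-positive acc (c ∷ y) = s≤s z≤n ∷ preFrom-positive (acc ++ [ c ]) y

length-preFrom : ∀ acc y → length (preFrom acc y) ≡ length y
length-preFrom acc []      = refl
length-preFrom acc (c ∷ y) = cong suc (length-preFrom (acc ++ [ c ]) y)

hasOne : List ℕ → Bool
hasOne = any (_≡ᵇ 1)

-- In insertMin i v with v positive the inserted 1 is the last 1, every later rank being
-- shifted up; so the position and v can be recovered.
lastOne : List ℕ → ℕ
lastOne []       = 0
lastOne (x ∷ xs) = if hasOne xs then suc (lastOne xs) else 0

deleteMin : List ℕ → List ℕ
deleteMin []       = []
deleteMin (x ∷ xs) = if hasOne xs then x ∷ deleteMin xs else map pred xs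

hasOne-insertMin : ∀ i v → hasOne (insertMin i v) ≡ true
hasOne-insertMin zero    v       = refl
hasOne-insertMin (suc i) []      = refl
hasOne-insertMin (suc i) (x ∷ v) rewrite hasOne-insertMin i v = ∨-zeroʳ (x ≡ᵇ 1)

hasOne-map-suc : ∀ {v} → All (0 <_) v → hasOne (map suc v) ≡ false
hasOne-map-suc []              = refl
hasOne-map-suc (s≤s z≤n ∷ 0<v) = hasOne-map-suc 0<v

lastOne-insertMin : ∀ i {v} → All (0 <_) v → i ≤ length v → lastOne (insertMin i v) ≡ i
lastOne-insertMin zero    {v}     0<v       _           =
  cong (λ b → if b then suc (lastOne (map suc v)) else 0) (hasOne-map-suc 0<v)
lastOne-insertMin (suc i) {x ∷ v} (_ ∷ 0<v) (s≤s i≤|v|) =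
  trans (cong (λ b → if b then suc (lastOne (insertMin i v)) else 0) (hasOne-insertMin i v))
        (cong suc (lastOne-insertMin i 0<v i≤|v|))

deleteMin-insertMin : ∀ i {v} → All (0 <_) v → deleteMin (insertMin i v) ≡ v
deleteMin-insertMin zero    {v}     0<v       =
  trans (cong (λ b → if b then 1 ∷ deleteMin (map suc v) else map pred (map suc v)) (hasOne-map-suc 0<v))
        (trans (sym (map-∘ v)) (map-id v))
deleteMin-insertMin (suc i) {[]}    _         = refl
deleteMin-insertMin (suc i) {x ∷ v} (_ ∷ 0<v) =
  trans (cong (λ b → if b then x ∷ deleteMin (insertMin i v) else map pred (insertMin i v)) (hasOne-insertMin i v))
        (cong (x ∷_) (deleteMin-insertMin i 0<v))

min-view : ∀ x xs → ∃₂ λ i a → ∃ λ ys → x ∷ xs ≡ insertAt i a ys × All (a ≤_) ys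
min-view x []       = 0 , x , [] , refl , []
min-view x (y ∷ ys) with min-view y ys
... | i , a , zs , y∷ys≡ , a≤zs with x ≤? a
...   | yes x≤a = 0 , x , y ∷ ys , refl ,
                  All.map (≤-trans x≤a) (subst (All (a ≤_)) (sym y∷ys≡) (All-insertAt⁺ i zs ≤-refl a≤zs))
...   | no  x≰a = suc i , a , x ∷ zs , cong (x ∷_) y∷ys≡ , <⇒≤ (≰⇒> x≰a) ∷ a≤zs

Unique-min-induction : (Q : List ℕ → Set) → Q [] →
                       (∀ i {a} ys → All (a <_) ys → Q ys → Q (insertAt i a ys)) →
                       ∀ Σ → Unique Σ → Q Σ
Unique-min-induction Q Q[] Q-insert Σ uΣ = go (length Σ) Σ refl uΣ
  where
  go : ∀ n Σ → length Σ ≡ n → Unique Σ → Q Σ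
  go _       []       _     _  = Q[]
  go (suc n) (x ∷ xs) |Σ|≡n uΣ with min-view x xs
  ... | i , a , ys , Σ≡ , a≤ys = subst Q (sym Σ≡) (Q-insert i ys a<ys (go n ys |ys|≡n (Unique-insertAt⁻ i ys u)))
    where
    u : Unique (insertAt i a ys)
    u = subst Unique Σ≡ uΣ
    a<ys : All (a <_) ys
    a<ys = All.zipWith (λ (a≤c , a≢c) → ≤∧≢⇒< a≤c a≢c) (a≤ys , Unique-insertAt⇒∉ i ys u)
    |ys|≡n : length ys ≡ n
    |ys|≡n = suc-injective (trans (sym (length-insertAt i ys)) (trans (cong length (sym Σ≡)) |Σ|≡n))

𝟙-distinct : List ℕ → ℕ
𝟙-distinct x = 𝟙 (unique? x)

𝟙-fibre : List ℕ → List ℕ → ℕ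
𝟙-fibre p x = 𝟙 (unique? x) * 𝟙 (≡-dec N._≟_ p (Pre x))

𝟙-distinct-supported : SupportedOnUnique 𝟙-distinct
𝟙-distinct-supported y = 𝟙-no (unique? y)

𝟙-fibre-supported : ∀ p → SupportedOnUnique (𝟙-fibre p)
𝟙-fibre-supported p y ¬uy = cong (_* 𝟙 (≡-dec N._≟_ p (Pre y))) (𝟙-no (unique? y) ¬uy)

𝟙-fibre≤𝟙-distinct : ∀ p x → 𝟙-fibre p x ≤ 𝟙-distinct x
𝟙-fibre≤𝟙-distinct p x = 𝟙*𝟙≤𝟙 (unique? x) (≡-dec N._≟_ p (Pre x))

𝟙-fibre-insertAt : ∀ p i a y → All (a <_) y → i ≤ length y → 𝟙-fibre p (insertAt i a y) ≢ 0 →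
                   i ≡ lastOne p × 𝟙-fibre p (insertAt i a y) ≤ 𝟙-fibre (deleteMin p) y
𝟙-fibre-insertAt p i a y a<y i≤|y| ≢0
  with 𝟙*𝟙≢0 (unique? (insertAt i a y)) (≡-dec N._≟_ p (Pre (insertAt i a y))) ≢0
... | u , p≡Pre = sym (trans (cong lastOne p≡insertMin) (lastOne-insertMin i 0<Pre i≤|Pre|)) ,
                  ≤-trans (≤-trans (𝟙-fibre≤𝟙-distinct p (insertAt i a y)) (𝟙≤1 (unique? (insertAt i a y))))
                          (≤-reflexive (sym (cong₂ _*_ (𝟙-yes (unique? y) (Unique-insertAt⁻ i y u))
                                                       (𝟙-yes (≡-dec N._≟_ (deleteMin p) (Pre y)) deleteMin-p≡Pre))))
  where
  p≡insertMin : p ≡ insertMin i (Pre y)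
  p≡insertMin = trans p≡Pre (Pre-insertAt-min i y a<y)
  0<Pre : All (0 <_) (Pre y)
  0<Pre = preFrom-positive [] y
  i≤|Pre| : i ≤ length (Pre y)
  i≤|Pre| = subst (i ≤_) (sym (length-preFrom [] y)) i≤|y|
  deleteMin-p≡Pre : deleteMin p ≡ Pre y
  deleteMin-p≡Pre = trans (cong deleteMin p≡insertMin) (deleteMin-insertMin i 0<Pre)

sumInsertions-𝟙-fibre : ∀ p a y → All (a <_) y → sumInsertions a (𝟙-fibre p) y ≤ 𝟙-fibre (deleteMin p) y
sumInsertions-𝟙-fibre p a y a<y = sumTo-≤-single (length y) (lastOne p) _ λ i i≤|y| → 𝟙-fibre-insertAt p i a y a<y i≤|y|

sumInsertions-𝟙-distinct : ∀ a y → All (a <_) y → suc (length y) * 𝟙-distinct y ≤ sumInsertions a 𝟙-distinct y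
sumInsertions-𝟙-distinct a y a<y = *-≤-sumTo (length y) _ _ λ i →
  𝟙-mono (Unique-insertAt⁺ i y (All.map <⇒≢ a<y)) (unique? y) (unique? (insertAt i a y))

fibre-count-zero : ∀ Σ p → 0 ! * sumWords Σ 0 (𝟙-fibre p) ≤ sumWords Σ 0 𝟙-distinct
fibre-count-zero Σ p = ≤-trans (≤-reflexive (*-identityˡ _)) (𝟙-fibre≤𝟙-distinct p [])

fibre-count-insertAt : ∀ i {a} Σ → All (a <_) Σ →
                       (∀ b p → b ! * sumWords Σ b (𝟙-fibre p) ≤ sumWords Σ b 𝟙-distinct) →
                       ∀ b p → b ! * sumWords (insertAt i a Σ) b (𝟙-fibre p) ≤ sumWords (insertAt i a Σ) b 𝟙-distinct
fibre-count-insertAt i {a} Σ a<Σ ih zero    p = fibre-count-zero (insertAt i a Σ) p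
fibre-count-insertAt i {a} Σ a<Σ ih (suc b) p = begin
  suc b ! * W⁺ (suc b) (𝟙-fibre p)                           ≡⟨ cong (suc b ! *_) (sumWords-insertAt i a Σ b _ (𝟙-fibre-supported p)) ⟩
  suc b ! * (W (suc b) (𝟙-fibre p) + W b (sumInsertions a (𝟙-fibre p)))
                                                              ≡⟨ *-distribˡ-+ (suc b !) _ _ ⟩
  suc b ! * W (suc b) (𝟙-fibre p) + suc b ! * W b (sumInsertions a (𝟙-fibre p))
                                                              ≤⟨ +-mono-≤ (ih (suc b) p) (*-monoʳ-≤ (suc b !) (sumWords-mono Σ b λ _ y⊆Σ →
                                                                   sumInsertions-𝟙-fibre p a _ (below y⊆Σ))) ⟩
  W (suc b) 𝟙-distinct + suc b * b ! * W b (𝟙-fibre (deleteMin p))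
                                                              ≡⟨ cong (W (suc b) 𝟙-distinct +_) (*-assoc (suc b) (b !) _) ⟩
  W (suc b) 𝟙-distinct + suc b * (b ! * W b (𝟙-fibre (deleteMin p)))
                                                              ≤⟨ +-monoʳ-≤ (W (suc b) 𝟙-distinct) (*-monoʳ-≤ (suc b) (ih b (deleteMin p))) ⟩
  W (suc b) 𝟙-distinct + suc b * W b 𝟙-distinct              ≡⟨ cong (W (suc b) 𝟙-distinct +_) (sumWords-* Σ b (suc b) 𝟙-distinct) ⟨
  W (suc b) 𝟙-distinct + W b (λ y → suc b * 𝟙-distinct y)   ≤⟨ +-monoʳ-≤ (W (suc b) 𝟙-distinct) (sumWords-mono Σ b λ {y} |y|≡b y⊆Σ →
                                                                   subst (λ n → suc n * 𝟙-distinct y ≤ _) |y|≡b (sumInsertions-𝟙-distinct a y (below y⊆Σ))) ⟩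
  W (suc b) 𝟙-distinct + W b (sumInsertions a 𝟙-distinct)   ≡⟨ sumWords-insertAt i a Σ b _ 𝟙-distinct-supported ⟨
  W⁺ (suc b) 𝟙-distinct                                      ∎
  where
  open ≤-Reasoning
  W W⁺ : ℕ → (List ℕ → ℕ) → ℕ
  W  = sumWords Σ
  W⁺ = sumWords (insertAt i a Σ)
  below : ∀ {y} → All (_∈ Σ) y → All (a <_) y
  below = All.map (All.lookup a<Σ)

fibre-count : ∀ Σ → Unique Σ → ∀ b p → b ! * sumWords Σ b (𝟙-fibre p) ≤ sumWords Σ b 𝟙-distinct
fibre-count = Unique-min-induction _ fibre-count-[] fibre-count-insertAt
  where
  fibre-count-[] : ∀ b p → b ! * sumWords [] b (𝟙-fibre p) ≤ sumWords [] b 𝟙-distinct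
  fibre-count-[] zero    p = fibre-count-zero [] p
  fibre-count-[] (suc b) p = ≤-reflexive (*-zeroʳ (suc b !))

blockPre : ℕ → ℕ → List ℕ → List ℕ
blockPre m b P = Pre (substr (take m P) (suc (m ∸ b)) m)

𝟙-distinct*verifCost : ∀ Ps m b x →
  𝟙-distinct x * verifCost Ps m b x ≡ sum (map (λ P → length P * 𝟙-fibre (blockPre m b P) x) Ps)
𝟙-distinct*verifCost Ps m b x = trans (sym (sum-map-* (𝟙-distinct x) _ Ps)) (sum-map-cong Ps λ P →
  trans (cong (𝟙-distinct x *_) (if-then-else-0 _ (length P))) (x*[y*z]≡y*[x*z] (𝟙-distinct x) (length P) _))

totalCost≡ : ∀ Ps Σ m b → totalCost Ps Σ m b ≡ sum (map (λ P → length P * sumWords Σ b (𝟙-fibre (blockPre m b P))) Ps)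
totalCost≡ Ps Σ m b = begin
  sum (map (verifCost Ps m b) (filter unique? (allStrings Σ b)))                   ≡⟨ sum-map-filter unique? _ (allStrings Σ b) ⟩
  sum (map (λ x → 𝟙-distinct x * verifCost Ps m b x) (allStrings Σ b))             ≡⟨ sum-map-allStrings Σ b _ ⟩
  sumWords Σ b (λ x → 𝟙-distinct x * verifCost Ps m b x)                           ≡⟨ sumWords-cong Σ b (𝟙-distinct*verifCost Ps m b) ⟩
  sumWords Σ b (λ x → sum (map (λ P → length P * 𝟙-fibre (blockPre m b P) x) Ps))  ≡⟨ sumWords-sum-map Σ b _ Ps ⟩
  sum (map (λ P → sumWords Σ b (λ x → length P * 𝟙-fibre (blockPre m b P) x)) Ps)  ≡⟨ sum-map-cong Ps (λ P → sumWords-* Σ b (length P) _) ⟩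
  sum (map (λ P → length P * sumWords Σ b (𝟙-fibre (blockPre m b P))) Ps)          ∎
  where open ≡-Reasoning

length-distinctStrings : ∀ Σ b → length (distinctStrings Σ b) ≡ sumWords Σ b 𝟙-distinct
length-distinctStrings Σ b = begin
  length (distinctStrings Σ b)                                     ≡⟨ length≡sum-map-1 (distinctStrings Σ b) ⟩
  sum (map (λ _ → 1) (filter unique? (allStrings Σ b)))            ≡⟨ sum-map-filter unique? _ (allStrings Σ b) ⟩
  sum (map (λ x → 𝟙-distinct x * 1) (allStrings Σ b))              ≡⟨ sum-map-allStrings Σ b _ ⟩
  sumWords Σ b (λ x → 𝟙-distinct x * 1)                            ≡⟨ sumWords-cong Σ b (λ x → *-identityʳ (𝟙-distinct x)) ⟩
  sumWords Σ b 𝟙-distinct                                          ∎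
  where open ≡-Reasoning

n<2^suc⌊log₂n⌋ : ∀ n → n < 2 ^ suc ⌊log₂ n ⌋
n<2^suc⌊log₂n⌋ n with 2 ^ suc ⌊log₂ n ⌋ ≤? n
... | no  2^≰n = ≰⇒> 2^≰n
... | yes 2^≤n = contradiction (subst (_≤ ⌊log₂ n ⌋) (⌊log₂[2^n]⌋≡n (suc ⌊log₂ n ⌋)) (⌊log₂⌋-mono-≤ 2^≤n)) 1+n≰n

2*⌊n/2⌋≤n : ∀ n → 2 * ⌊ n /2⌋ ≤ n
2*⌊n/2⌋≤n n = begin
  2 * ⌊ n /2⌋            ≡⟨ cong (⌊ n /2⌋ +_) (+-identityʳ ⌊ n /2⌋) ⟩
  ⌊ n /2⌋ + ⌊ n /2⌋     ≤⟨ +-monoʳ-≤ ⌊ n /2⌋ (⌊n/2⌋≤⌈n/2⌉ n) ⟩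
  ⌊ n /2⌋ + ⌈ n /2⌉     ≡⟨ ⌊n/2⌋+⌈n/2⌉≡n n ⟩
  n                     ∎
  where open ≤-Reasoning

2^⌊log₂n⌋≤n : ∀ n → 1 ≤ n → 2 ^ ⌊log₂ n ⌋ ≤ n
2^⌊log₂n⌋≤n n = bound ⌊log₂ n ⌋ n refl
  where
  bound : ∀ L n → ⌊log₂ n ⌋ ≡ L → 1 ≤ n → 2 ^ L ≤ n
  bound zero          n             _    1≤n = 1≤n
  bound (suc L)       1             log≡ _   = contradiction (trans (sym (⌊log₂[2^n]⌋≡n 0)) log≡) λ ()
  bound (suc L) n@(suc (suc _)) log≡ _   = begin
    2 * 2 ^ L      ≤⟨ *-monoʳ-≤ 2 (bound L ⌊ n /2⌋ log⌊n/2⌋≡L (s≤s z≤n)) ⟩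
    2 * ⌊ n /2⌋   ≤⟨ 2*⌊n/2⌋≤n n ⟩
    n             ∎
    where
    open ≤-Reasoning
    log⌊n/2⌋≡L : ⌊log₂ ⌊ n /2⌋ ⌋ ≡ L
    log⌊n/2⌋≡L = trans (⌊log₂⌊n/2⌋⌋≡⌊log₂n⌋∸1 n) (cong (_∸ 1) log≡)

n<2^2^suc⌊log₂⌊log₂n⌋⌋ : ∀ n → n < 2 ^ 2 ^ suc ⌊log₂ ⌊log₂ n ⌋ ⌋
n<2^2^suc⌊log₂⌊log₂n⌋⌋ n = <-≤-trans (n<2^suc⌊log₂n⌋ n) (^-monoʳ-≤ 2 (n<2^suc⌊log₂n⌋ ⌊log₂ n ⌋))

t^d≤[t+d]! : ∀ t d → t ^ d ≤ (t + d) !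
t^d≤[t+d]! t zero    = 1≤n! (t + 0)
t^d≤[t+d]! t (suc d) rewrite +-suc t d = *-mono-≤ (m≤n⇒m≤1+n (m≤m+n t d)) (t^d≤[t+d]! t d)

144*s+127≤3*2^s : ∀ s → 9 ≤ s → 144 * s + 127 ≤ 3 * 2 ^ s
144*s+127≤3*2^s s 9≤s = subst (λ s → 144 * s + 127 ≤ 3 * 2 ^ s) (m+[n∸m]≡n 9≤s) (from9 (s ∸ 9))
  where
  from9 : ∀ d → 144 * (9 + d) + 127 ≤ 3 * 2 ^ (9 + d)
  from9 zero    = m≤m+n 1423 113
  from9 (suc d) = begin
    144 * (10 + d) + 127                        ≡⟨ step d ⟩
    (144 * (9 + d) + 127) + 144                 ≤⟨ +-monoʳ-≤ (144 * (9 + d) + 127) (≤-trans (m≤m+n 144 (144 * d + 1279)) (≤-reflexive (split d))) ⟩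
    (144 * (9 + d) + 127) + (144 * (9 + d) + 127) ≤⟨ +-mono-≤ (from9 d) (from9 d) ⟩
    3 * 2 ^ (9 + d) + 3 * 2 ^ (9 + d)           ≡⟨ double (2 ^ (9 + d)) ⟩
    3 * 2 ^ (10 + d)                            ∎
    where
    open ≤-Reasoning
    step : ∀ d → 144 * (10 + d) + 127 ≡ (144 * (9 + d) + 127) + 144
    step = solve-∀
    split : ∀ d → 144 + (144 * d + 1279) ≡ 144 * (9 + d) + 127
    split = solve-∀
    double : ∀ x → 3 * x + 3 * x ≡ 3 * (2 * x)
    double = solve-∀

0<⌊log₂n⌋⇒0<n : ∀ n → 0 < ⌊log₂ n ⌋ → 0 < n
0<⌊log₂n⌋⇒0<n zero    0<log0 = contradiction (≤-trans 0<log0 (⌊log₂⌋-mono-≤ {0} {1} z≤n)) (subst (1 ≰_) (sym (⌊log₂[2^n]⌋≡n 0)) λ ())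
0<⌊log₂n⌋⇒0<n (suc n) _      = s≤s z≤n

exponent-gap : ∀ {L k r s b} → 2 ^ k ≤ L → r + s ≡ k → s * 6 ≤ k → k ≤ 5 + s * 6 → 9 ≤ s →
               3 * L < 2 * suc b * k → r * 2 ^ r + suc L ≤ r * b
exponent-gap {L} {k} {r} {s} {b} 2^k≤L r+s≡k 6s≤k k≤5+6s 9≤s 3L<2[1+b]k =
  *-cancelˡ-≤ (12 * k) {{>-nonZero 0<12k}} (+-cancelʳ-≤ (12 * k * r) _ _ (begin
    12 * k * (r * t + suc L) + 12 * k * r          ≡⟨ e₁ k r t L ⟩
    k * ((12 * r * t + 12 * r + 7) + (12 * L + 5)) ≤⟨ *-monoʳ-≤ k (+-monoˡ-≤ (12 * L + 5) rt-bound) ⟩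
    k * (3 * L + (12 * L + 5))                     ≡⟨ e₂ k L ⟩
    5 * k * suc (3 * L)                            ≤⟨ *-monoˡ-≤ (suc (3 * L)) 5k≤6r ⟩
    6 * r * suc (3 * L)                            ≤⟨ *-monoʳ-≤ (6 * r) 3L<2[1+b]k ⟩
    6 * r * (2 * suc b * k)                        ≡⟨ e₃ r b k ⟩
    12 * k * (r * b) + 12 * k * r                  ∎))
  where
  open ≤-Reasoning
  e₁ : ∀ k r t L → 12 * k * (r * t + suc L) + 12 * k * r ≡ k * ((12 * r * t + 12 * r + 7) + (12 * L + 5))
  e₁ = solve-∀
  e₂ : ∀ k L → k * (3 * L + (12 * L + 5)) ≡ 5 * k * suc (3 * L)
  e₂ = solve-∀
  e₃ : ∀ r b k → 6 * r * (2 * suc b * k) ≡ 12 * k * (r * b) + 12 * k * r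
  e₃ = solve-∀
  e₄ : ∀ k → 5 * k + k ≡ 6 * k
  e₄ = solve-∀
  e₅ : ∀ k t → 12 * k * t + 12 * k * t + 7 * t ≡ (24 * k + 7) * t
  e₅ = solve-∀
  e₆ : ∀ s → 24 * (5 + s * 6) + 7 ≡ 144 * s + 127
  e₆ = solve-∀
  t = 2 ^ r
  0<12k : 0 < 12 * k
  0<12k = ≤-trans (≤-trans (≤-trans (s≤s z≤n) 9≤s) (m≤m*n s 6)) (≤-trans 6s≤k (m≤n*m k 12))
  r≤k : r ≤ k
  r≤k = subst (r ≤_) r+s≡k (m≤m+n r s)
  2^k≡2^s*t : 2 ^ k ≡ 2 ^ s * t
  2^k≡2^s*t = trans (cong (2 ^_) (trans (sym r+s≡k) (+-comm r s))) (^-distribˡ-+-* 2 s r)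
  5k≤6r : 5 * k ≤ 6 * r
  5k≤6r = +-cancelʳ-≤ k (5 * k) (6 * r) (begin
    5 * k + k         ≡⟨ e₄ k ⟩
    6 * k             ≡⟨ cong (6 *_) (sym r+s≡k) ⟩
    6 * (r + s)       ≡⟨ trans (*-distribˡ-+ 6 r s) (cong (6 * r +_) (*-comm 6 s)) ⟩
    6 * r + s * 6     ≤⟨ +-monoʳ-≤ (6 * r) 6s≤k ⟩
    6 * r + k         ∎)
  rt-bound : 12 * r * t + 12 * r + 7 ≤ 3 * L
  rt-bound = begin
    12 * r * t + 12 * r + 7          ≤⟨ +-mono-≤ (+-mono-≤ (*-monoˡ-≤ t (*-monoʳ-≤ 12 r≤k))
                                                          (≤-trans (*-monoʳ-≤ 12 r≤k) (m≤m*n (12 * k) t {{m^n≢0 2 r}})))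
                                                (*-monoʳ-≤ 7 (m^n>0 2 r)) ⟩
    12 * k * t + 12 * k * t + 7 * t  ≡⟨ e₅ k t ⟩
    (24 * k + 7) * t                 ≤⟨ *-monoˡ-≤ t (≤-trans (+-monoˡ-≤ 7 (*-monoʳ-≤ 24 k≤5+6s)) (≤-reflexive (e₆ s))) ⟩
    (144 * s + 127) * t              ≤⟨ *-monoˡ-≤ t (144*s+127≤3*2^s s 9≤s) ⟩
    3 * 2 ^ s * t                    ≡⟨ trans (*-assoc 3 (2 ^ s) t) (cong (3 *_) (sym 2^k≡2^s*t)) ⟩
    3 * 2 ^ k                        ≤⟨ *-monoʳ-≤ 3 2^k≤L ⟩
    3 * L                            ∎
n≤b! : ∀ n b → 54 ≤ ⌊log₂ ⌊log₂ n ⌋ ⌋ → 3 * ⌊log₂ n ⌋ < 2 * suc b * ⌊log₂ ⌊log₂ n ⌋ ⌋ → n ≤ b !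
n≤b! n b 54≤k 3L<2[1+b]k = begin
  n                   ≤⟨ <⇒≤ (n<2^suc⌊log₂n⌋ n) ⟩
  2 ^ suc L           ≤⟨ ^-monoʳ-≤ 2 1+L≤r[b∸t] ⟩
  2 ^ (r * (b ∸ t))   ≡⟨ ^-*-assoc 2 r (b ∸ t) ⟨
  t ^ (b ∸ t)         ≤⟨ t^d≤[t+d]! t (b ∸ t) ⟩
  (t + (b ∸ t)) !     ≡⟨ cong _! (m+[n∸m]≡n t≤b) ⟩
  b !                 ∎
  where
  open ≤-Reasoning
  L = ⌊log₂ n ⌋
  k = ⌊log₂ L ⌋
  s = k / 6
  r = k ∸ s
  t = 2 ^ r
  k≡k%6+s*6 : k ≡ k % 6 + s * 6
  k≡k%6+s*6 = m≡m%n+[m/n]*n k 6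
  6s≤k : s * 6 ≤ k
  6s≤k = ≤-trans (m≤n+m (s * 6) (k % 6)) (≤-reflexive (sym k≡k%6+s*6))
  k≤5+6s : k ≤ 5 + s * 6
  k≤5+6s = ≤-trans (≤-reflexive k≡k%6+s*6) (+-monoˡ-≤ (s * 6) (≤-pred (m%n<n k 6)))
  9≤s : 9 ≤ s
  9≤s = ≮⇒≥ λ s<9 → 1+n≰n (≤-trans 54≤k (≤-trans k≤5+6s (+-monoʳ-≤ 5 (*-monoˡ-≤ 6 (≤-pred s<9)))))
  gap : r * t + suc L ≤ r * b
  gap = exponent-gap (2^⌊log₂n⌋≤n L (0<⌊log₂n⌋⇒0<n L (≤-trans (s≤s z≤n) 54≤k)))
                     (m∸n+n≡m (≤-trans (m≤m*n s 6) 6s≤k)) 6s≤k k≤5+6s 9≤s 3L<2[1+b]k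
  t≤b : t ≤ b
  t≤b = ≮⇒≥ λ b<t → contradiction (+-cancelˡ-≤ (r * t) (suc L) 0
          (≤-trans gap (≤-trans (*-monoʳ-≤ r (<⇒≤ b<t)) (≤-reflexive (sym (+-identityʳ (r * t))))))) λ ()
  1+L≤r[b∸t] : suc L ≤ r * (b ∸ t)
  1+L≤r[b∸t] = +-cancelˡ-≤ (r * t) _ _ (≤-trans gap (≤-reflexive (trans (cong (r *_) (sym (m+[n∸m]≡n t≤b))) (*-distribˡ-+ r t (b ∸ t)))))

-- Stated for every K ≥ 54 rather than for 54 itself, so that 2 ^ 2 ^ 54 is never evaluated.
n≤b!*2^2^K : ∀ K n b → 54 ≤ K → 3 * ⌊log₂ n ⌋ < 2 * suc b * ⌊log₂ ⌊log₂ n ⌋ ⌋ → n ≤ b ! * 2 ^ 2 ^ K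
n≤b!*2^2^K K n b 54≤K 3L<2[1+b]k with ⌊log₂ ⌊log₂ n ⌋ ⌋ <? 54
... | yes k<54 = ≤-trans (<⇒≤ (<-≤-trans (n<2^2^suc⌊log₂⌊log₂n⌋⌋ n) (^-monoʳ-≤ 2 (^-monoʳ-≤ 2 (≤-trans k<54 54≤K)))))
                         (m≤n*m (2 ^ 2 ^ K) (b !) {{b !≢0}})
... | no  k≮54 = ≤-trans (n≤b! n b (≮⇒≥ k≮54) 3L<2[1+b]k) (m≤m*n (b !) (2 ^ 2 ^ K) {{m^n≢0 2 (2 ^ K)}})

lemma6 : ∃ λ (C : ℕ) →
    (Σ : List ℕ) → Unique Σ →
    (Ps : List (List ℕ)) → All (All (_∈ Σ)) Ps →
    (m : ℕ) → All (λ P → m ≤ length P) Ps → Any (λ P → length P ≡ m) Ps →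
    (b : ℕ) →
    1 ≤ ⌊log₂ ⌊log₂ totalLength Ps ⌋ ⌋ →
    2 * b * ⌊log₂ ⌊log₂ totalLength Ps ⌋ ⌋ ≤ 3 * ⌊log₂ totalLength Ps ⌋ →
    3 * ⌊log₂ totalLength Ps ⌋ < 2 * suc b * ⌊log₂ ⌊log₂ totalLength Ps ⌋ ⌋ →
    b ≤ m → b ≤ length Σ →
    All (λ P → ∀ j → j + b ≤ m → Unique (take b (drop j (take m P)))) Ps →
    totalCost Ps Σ m b ≤ C * length (distinctStrings Σ b)
lemma6 = 2 ^ 2 ^ 54 , λ Σ uΣ Ps _ m _ _ b _ _ 3L<2[1+b]k _ _ _ → *-cancelˡ-≤ (b !) {{b !≢0}} (begin
  b ! * totalCost Ps Σ m b
    ≡⟨ cong (b ! *_) (totalCost≡ Ps Σ m b) ⟩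
  b ! * sum (map (λ P → length P * sumWords Σ b (𝟙-fibre (blockPre m b P))) Ps)
    ≤⟨ *-sum-map-≤ (b !) (length (distinctStrings Σ b)) length _ Ps (λ P →
         ≤-trans (fibre-count Σ uΣ b (blockPre m b P)) (≤-reflexive (sym (length-distinctStrings Σ b)))) ⟩
  totalLength Ps * length (distinctStrings Σ b)
    ≤⟨ *-monoˡ-≤ _ (n≤b!*2^2^K 54 (totalLength Ps) b ≤-refl 3L<2[1+b]k) ⟩
  b ! * 2 ^ 2 ^ 54 * length (distinctStrings Σ b)
    ≡⟨ *-assoc (b !) (2 ^ 2 ^ 54) _ ⟩
  b ! * (2 ^ 2 ^ 54 * length (distinctStrings Σ b)) ∎)
  where open ≤-Reasoning
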